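{- Let $G$ be an undirected graph, $L,R\subseteq V_G$ disjoint with $L\cup R\neq\emptyset$, and let $H$ be the double cover of $G$. Then $\Phi_H(L_1\cup R_2)=\beta_G(L,R)$.
   Context: $G=(V_G,E_G,w)$ with degrees $\deg(v)=\sum_u w(v,u)$ and $\mathrm{vol}(S)=\sum_{v\in S}\deg(v)$; $w(L,R)=\sum_{a\in L,b\in R}w(a,b)$ and the bipartiteness is $\beta_G(L,R)=1-2w(L,R)/\mathrm{vol}(L\cup R)$. The double cover $H$ has vertex set $\{v_1,v_2:v\in V_G\}$ and for every edge $\{u,v\}\in E_G$ the edges $\{u_1,v_2\}$ and $\{u_2,v_1\}$ of the same weight. For $S\subseteq V_G$, $S_1=\{v_1:v\in S\}$ and $S_2=\{v_2:v\in S\}$. The conductance in $H$ is $\Phi_H(S)=w_H(S,V_H\setminus S)/\min\{\mathrm{vol}_H(S),\mathrm{vol}_H(V_H\setminus S)\}$.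
   Formalization: The edge weights of G are nonnegative rationals instead of nonnegative reals. -}

module Defs where

open import Data.Nat as ℕ using (ℕ; zero; suc)
open import Data.Fin using (Fin; zero; suc; splitAt)
open import Data.Fin.Subset using (Subset; ∁; _∪_)
open import Data.Vec using (lookup; _++_)
open import Data.Bool using (Bool; true; false; if_then_else_)
open import Data.Sum using (inj₁; inj₂)
open import Data.Rational using (_≤_; ℚ; 0ℚ; 1ℚ; _+_; _*_; _-_; _÷_; _⊓_; ≢-nonZero)
open import Data.Rational.Properties using (_≟_)
open import Relation.Nullary using (yes; no)
open import Relation.Binary.PropositionalEquality using (_≡_)

-- A weighted undirected graph on vertex set Fin n: a weight function
-- (weight 0 = no edge); undirectedness/non-negativity are hypotheses.
Weight : ℕ → Set
Weight n = Fin n → Fin n → ℚ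

Symmetric : ∀ {n} → Weight n → Set
Symmetric w = ∀ u v → w u v ≡ w v u

NonNegative : ∀ {n} → Weight n → Set
NonNegative w = ∀ u v → 0ℚ ≤ w u v

Σ : ∀ {n} → (Fin n → ℚ) → ℚ
Σ {zero}  f = 0ℚ
Σ {suc n} f = f zero + Σ (λ i → f (suc i))

[_∋_] : ∀ {n} → Subset n → Fin n → ℚ
[ S ∋ v ] = if lookup S v then 1ℚ else 0ℚ

deg : ∀ {n} → Weight n → Fin n → ℚ
deg w v = Σ (λ u → w v u)

vol : ∀ {n} → Weight n → Subset n → ℚ
vol w S = Σ (λ v → [ S ∋ v ] * deg w v)

cut : ∀ {n} → Weight n → Subset n → Subset n → ℚ
cut w A B = Σ (λ a → Σ (λ b → [ A ∋ a ] * ([ B ∋ b ] * w a b)))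

-- division p / q; only used where q ≠ 0 (value 0 at q = 0 is a dummy)
_/?_ : ℚ → ℚ → ℚ
p /? q with q ≟ 0ℚ
... | yes _ = 0ℚ
... | no q≢0 = _÷_ p q {{≢-nonZero q≢0}}

β : ∀ {n} → Weight n → Subset n → Subset n → ℚ
β w L R = 1ℚ - ((1ℚ + 1ℚ) * cut w L R) /? vol w (L ∪ R)

Φ : ∀ {n} → Weight n → Subset n → ℚ
Φ w S = cut w S (∁ S) /? (vol w S ⊓ vol w (∁ S))

-- Double cover H: vertex set Fin (n + n); v₁ = v ↑ˡ n (first block),
-- v₂ = n ↑ʳ v (second block).  Edges {u₁,v₂} and {u₂,v₁} of weight w(u,v).
doubleCover : ∀ {n} → Weight n → Weight (n ℕ.+ n)
doubleCover {n} w x y with splitAt n x | splitAt n y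
... | inj₁ u | inj₂ v = w u v
... | inj₂ u | inj₁ v = w u v
... | inj₁ _ | inj₁ _ = 0ℚ
... | inj₂ _ | inj₂ _ = 0ℚ

-- S₁ ∪ T₂ as a subset of V_H: first block marks S, second marks T.
copies : ∀ {n} → Subset n → Subset n → Subset (n ℕ.+ n)
copies S T = S ++ T

{-# OPTIONS --safe #-}
-- In the double cover, S = L₁ ∪ R₂ has volume vol(L) + vol(R) = vol(L ∪ R), and
-- this is the smaller side since L ⊆ V∖R and R ⊆ V∖L.  The edges leaving S are
-- those from L to V∖R and from R to V∖L; splitting the degrees in L by whether
-- the other endpoint lies in R, and those in R by whether it lies in L, gives
-- vol(L ∪ R) = w_H(S, V_H∖S) + 2 w(L,R), whence Φ_H(S) = 1 − 2 w(L,R) / vol(L ∪ R).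
module Submission where

open import Defs
open import Data.Nat as ℕ using (ℕ; zero; suc)
open import Data.Fin.Subset using (Subset; _∩_; _∪_; Empty; Nonempty)
open import Data.Rational using (0ℚ)
open import Relation.Binary.PropositionalEquality using (_≡_; _≢_)

open import Algebra.Bundles using (Ring)
open import Data.Bool using (true; false; not; _∨_; if_then_else_)
open import Data.Fin using (Fin; zero; suc; _↑ˡ_; _↑ʳ_)
open import Data.Fin.Properties using (splitAt-↑ˡ; splitAt-↑ʳ)
open import Data.Fin.Subset using (∁; _⊆_)
open import Data.Fin.Subset.Properties using (x∈p∩q⁺; x∉p⇒x∈∁p; ∩-comm)
open import Data.Product using (_,_)
open import Data.Rational using (ℚ; 1ℚ; _+_; _*_; _-_; _≤_; _⊓_; 1/_; nonNegative; ≢-nonZero)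
open import Data.Rational.Properties
  using ( _≟_; ≤-refl; ≤-reflexive; +-mono-≤; *-monoʳ-≤-nonNeg; p≤q⇒p⊓q≡p; nonNegative⁻¹
        ; +-identityˡ; +-identityʳ; +-assoc; +-comm; *-identityˡ; *-zeroʳ; *-distribˡ-+; *-distribʳ-+
        ; *-inverseʳ; +-*-ring; module ≤-Reasoning)
open import Data.Rational.Solver using (module +-*-Solver)
open import Data.Vec using (lookup)
open import Data.Vec.Properties
  using (lookup-++ˡ; lookup-++ʳ; lookup-map; lookup-zipWith; map-++; []=⇒lookup; lookup⇒[]=)
open import Relation.Binary.PropositionalEquality
  using (refl; sym; trans; cong; cong₂; subst; module ≡-Reasoning)
open import Relation.Nullary using (yes; no; contradiction)

open import Algebra.Properties.Semiring.Sum (Ring.semiring +-*-ring)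
  using (sum; sum-cong-≗; sum-replicate-zero; ∑-distrib-+; ∑-comm; *-distribˡ-sum)

private
  variable
    m n : ℕ

Σ≡sum : (f : Fin n → ℚ) → Σ f ≡ sum f
Σ≡sum {zero}  f = refl
Σ≡sum {suc n} f = cong (f zero +_) (Σ≡sum (λ i → f (suc i)))

Σ-cong : {f g : Fin n → ℚ} → (∀ i → f i ≡ g i) → Σ f ≡ Σ g
Σ-cong {f = f} {g} f≗g rewrite Σ≡sum f | Σ≡sum g = sum-cong-≗ f≗g

Σ-zero : ∀ n → Σ {n} (λ _ → 0ℚ) ≡ 0ℚ
Σ-zero n rewrite Σ≡sum {n} (λ _ → 0ℚ) = sum-replicate-zero n

Σ-+ : (f g : Fin n → ℚ) → Σ (λ i → f i + g i) ≡ Σ f + Σ g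
Σ-+ f g rewrite Σ≡sum (λ i → f i + g i) | Σ≡sum f | Σ≡sum g = ∑-distrib-+ f g

Σ-*ˡ : ∀ c (f : Fin n → ℚ) → Σ (λ i → c * f i) ≡ c * Σ f
Σ-*ˡ c f rewrite Σ≡sum (λ i → c * f i) | Σ≡sum f = sym (*-distribˡ-sum c f)

Σ-comm : (f : Fin m → Fin n → ℚ) → Σ (λ i → Σ (λ j → f i j)) ≡ Σ (λ j → Σ (λ i → f i j))
Σ-comm f = begin
  Σ (λ i → Σ (f i))               ≡⟨ Σ-cong (λ i → Σ≡sum (f i)) ⟩
  Σ (λ i → sum (f i))             ≡⟨ Σ≡sum (λ i → sum (f i)) ⟩
  sum (λ i → sum (f i))           ≡⟨ ∑-comm f ⟩
  sum (λ j → sum (λ i → f i j))   ≡⟨ Σ≡sum (λ j → sum (λ i → f i j)) ⟨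
  Σ (λ j → sum (λ i → f i j))     ≡⟨ Σ-cong (λ j → Σ≡sum (λ i → f i j)) ⟨
  Σ (λ j → Σ (λ i → f i j))       ∎
  where open ≡-Reasoning

Σ-mono : {f g : Fin n → ℚ} → (∀ i → f i ≤ g i) → Σ f ≤ Σ g
Σ-mono {zero}  f≤g = ≤-refl
Σ-mono {suc n} f≤g = +-mono-≤ (f≤g zero) (Σ-mono (λ i → f≤g (suc i)))

Σ-↑ˡ-↑ʳ : ∀ m n (f : Fin (m ℕ.+ n) → ℚ) → Σ f ≡ Σ (λ i → f (i ↑ˡ n)) + Σ (λ j → f (m ↑ʳ j))
Σ-↑ˡ-↑ʳ zero    n f = sym (+-identityˡ _)
Σ-↑ˡ-↑ʳ (suc m) n f =
  trans (cong (f zero +_) (Σ-↑ˡ-↑ʳ m n (λ i → f (suc i)))) (sym (+-assoc (f zero) _ _))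

[∋]-nonNeg : (S : Subset n) (v : Fin n) → 0ℚ ≤ [ S ∋ v ]
[∋]-nonNeg S v with lookup S v
... | true  = nonNegative⁻¹ 1ℚ
... | false = ≤-refl

[∋]-mono : {S T : Subset n} → S ⊆ T → ∀ v → [ S ∋ v ] ≤ [ T ∋ v ]
[∋]-mono {S = S} {T} S⊆T v with lookup S v in v∈S
... | true  = ≤-reflexive (cong (if_then 1ℚ else 0ℚ) (sym ([]=⇒lookup (S⊆T (lookup⇒[]= v S v∈S)))))
... | false = [∋]-nonNeg T v

[∋]+[∁∋] : (S : Subset n) (v : Fin n) → [ S ∋ v ] + [ ∁ S ∋ v ] ≡ 1ℚ
[∋]+[∁∋] S v rewrite lookup-map v not S with lookup S v
... | true  = refl
... | false = refl

[∪∋] : {S T : Subset n} → Empty (S ∩ T) → ∀ v → [ S ∪ T ∋ v ] ≡ [ S ∋ v ] + [ T ∋ v ]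
[∪∋] {S = S} {T} S∩T≡∅ v rewrite lookup-zipWith _∨_ v S T with lookup S v in v∈S | lookup T v in v∈T
... | true  | true  = contradiction (v , x∈p∩q⁺ (lookup⇒[]= v S v∈S , lookup⇒[]= v T v∈T)) S∩T≡∅
... | true  | false = refl
... | false | true  = refl
... | false | false = refl

disjoint⇒⊆∁ : {S T : Subset n} → Empty (S ∩ T) → S ⊆ ∁ T
disjoint⇒⊆∁ S∩T≡∅ x∈S = x∉p⇒x∈∁p (λ x∈T → S∩T≡∅ (_ , x∈p∩q⁺ (x∈S , x∈T)))

Σ-[∋]+Σ-[∁∋] : (S : Subset n) (f : Fin n → ℚ) →
               Σ (λ i → [ S ∋ i ] * f i) + Σ (λ i → [ ∁ S ∋ i ] * f i) ≡ Σ f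
Σ-[∋]+Σ-[∁∋] S f =
  trans (sym (Σ-+ (λ i → [ S ∋ i ] * f i) (λ i → [ ∁ S ∋ i ] * f i))) (Σ-cong λ i → begin
  [ S ∋ i ] * f i + [ ∁ S ∋ i ] * f i   ≡⟨ *-distribʳ-+ (f i) [ S ∋ i ] [ ∁ S ∋ i ] ⟨
  ([ S ∋ i ] + [ ∁ S ∋ i ]) * f i       ≡⟨ cong (_* f i) ([∋]+[∁∋] S i) ⟩
  1ℚ * f i                               ≡⟨ *-identityˡ (f i) ⟩
  f i                                    ∎)
  where open ≡-Reasoning

module _ (w : Weight n) where

  deg-nonNeg : NonNegative w → ∀ v → 0ℚ ≤ deg w v
  deg-nonNeg w≥0 v = subst (_≤ deg w v) (Σ-zero n) (Σ-mono (w≥0 v))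

  vol-mono : NonNegative w → {S T : Subset n} → S ⊆ T → vol w S ≤ vol w T
  vol-mono w≥0 S⊆T = Σ-mono λ v →
    *-monoʳ-≤-nonNeg (deg w v) {{nonNegative (deg-nonNeg w≥0 v)}} ([∋]-mono S⊆T v)

  vol-∪ : {S T : Subset n} → Empty (S ∩ T) → vol w (S ∪ T) ≡ vol w S + vol w T
  vol-∪ {S} {T} S∩T≡∅ = trans
    (Σ-cong λ v → trans (cong (_* deg w v) ([∪∋] S∩T≡∅ v)) (*-distribʳ-+ (deg w v) [ S ∋ v ] [ T ∋ v ]))
    (Σ-+ (λ v → [ S ∋ v ] * deg w v) (λ v → [ T ∋ v ] * deg w v))

  cut≡[∋]*Σ : (S T : Subset n) → cut w S T ≡ Σ (λ a → [ S ∋ a ] * Σ (λ b → [ T ∋ b ] * w a b))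
  cut≡[∋]*Σ S T = Σ-cong λ a → Σ-*ˡ [ S ∋ a ] (λ b → [ T ∋ b ] * w a b)

  vol≡cut+cut∁ : (S T : Subset n) → vol w S ≡ cut w S T + cut w S (∁ T)
  vol≡cut+cut∁ S T = sym (begin
    cut w S T + cut w S (∁ T)
      ≡⟨ cong₂ _+_ (cut≡[∋]*Σ S T) (cut≡[∋]*Σ S (∁ T)) ⟩
    Σ (λ a → [ S ∋ a ] * into T a) + Σ (λ a → [ S ∋ a ] * into (∁ T) a)
      ≡⟨ Σ-+ (λ a → [ S ∋ a ] * into T a) (λ a → [ S ∋ a ] * into (∁ T) a) ⟨
    Σ (λ a → [ S ∋ a ] * into T a + [ S ∋ a ] * into (∁ T) a)
      ≡⟨ Σ-cong (λ a → *-distribˡ-+ [ S ∋ a ] (into T a) (into (∁ T) a)) ⟨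
    Σ (λ a → [ S ∋ a ] * (into T a + into (∁ T) a))
      ≡⟨ Σ-cong (λ a → cong ([ S ∋ a ] *_) (Σ-[∋]+Σ-[∁∋] T (w a))) ⟩
    vol w S ∎)
    where
      open ≡-Reasoning
      into : Subset n → Fin n → ℚ
      into U a = Σ (λ b → [ U ∋ b ] * w a b)

  cut-comm : Symmetric w → (S T : Subset n) → cut w S T ≡ cut w T S
  cut-comm w-sym S T = trans (Σ-comm (λ a b → [ S ∋ a ] * ([ T ∋ b ] * w a b)))
    (Σ-cong λ b → Σ-cong λ a → trans (swap [ S ∋ a ] [ T ∋ b ] (w a b))
                                     (cong (λ x → [ T ∋ b ] * ([ S ∋ a ] * x)) (w-sym a b)))
    where
      open +-*-Solver
      swap : ∀ x y z → x * (y * z) ≡ y * (x * z)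
      swap = solve 3 (λ x y z → x :* (y :* z) := y :* (x :* z)) refl

module DoubleCover (w : Weight n) where

  H : Weight (n ℕ.+ n)
  H = doubleCover w

  H-↑ˡ-↑ˡ : ∀ i j → H (i ↑ˡ n) (j ↑ˡ n) ≡ 0ℚ
  H-↑ˡ-↑ˡ i j rewrite splitAt-↑ˡ n i n | splitAt-↑ˡ n j n = refl

  H-↑ˡ-↑ʳ : ∀ i j → H (i ↑ˡ n) (n ↑ʳ j) ≡ w i j
  H-↑ˡ-↑ʳ i j rewrite splitAt-↑ˡ n i n | splitAt-↑ʳ n n j = refl

  H-↑ʳ-↑ˡ : ∀ i j → H (n ↑ʳ i) (j ↑ˡ n) ≡ w i j
  H-↑ʳ-↑ˡ i j rewrite splitAt-↑ʳ n n i | splitAt-↑ˡ n j n = refl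

  H-↑ʳ-↑ʳ : ∀ i j → H (n ↑ʳ i) (n ↑ʳ j) ≡ 0ℚ
  H-↑ʳ-↑ʳ i j rewrite splitAt-↑ʳ n n i | splitAt-↑ʳ n n j = refl

  Σ-row-↑ˡ : (g : Fin (n ℕ.+ n) → ℚ → ℚ) → (∀ y → g y 0ℚ ≡ 0ℚ) →
             ∀ i → Σ (λ y → g y (H (i ↑ˡ n) y)) ≡ Σ (λ j → g (n ↑ʳ j) (w i j))
  Σ-row-↑ˡ g g0≡0 i = begin
    Σ (λ y → g y (H (i ↑ˡ n) y))
      ≡⟨ Σ-↑ˡ-↑ʳ n n (λ y → g y (H (i ↑ˡ n) y)) ⟩
    Σ (λ j → g (j ↑ˡ n) (H (i ↑ˡ n) (j ↑ˡ n))) + Σ (λ j → g (n ↑ʳ j) (H (i ↑ˡ n) (n ↑ʳ j)))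
      ≡⟨ cong₂ _+_ (Σ-cong λ j → trans (cong (g _) (H-↑ˡ-↑ˡ i j)) (g0≡0 _))
                   (Σ-cong λ j → cong (g _) (H-↑ˡ-↑ʳ i j)) ⟩
    Σ {n} (λ _ → 0ℚ) + Σ (λ j → g (n ↑ʳ j) (w i j))
      ≡⟨ cong (_+ Σ (λ j → g (n ↑ʳ j) (w i j))) (Σ-zero n) ⟩
    0ℚ + Σ (λ j → g (n ↑ʳ j) (w i j))
      ≡⟨ +-identityˡ (Σ (λ j → g (n ↑ʳ j) (w i j))) ⟩
    Σ (λ j → g (n ↑ʳ j) (w i j)) ∎
    where open ≡-Reasoning

  Σ-row-↑ʳ : (g : Fin (n ℕ.+ n) → ℚ → ℚ) → (∀ y → g y 0ℚ ≡ 0ℚ) →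
             ∀ i → Σ (λ y → g y (H (n ↑ʳ i) y)) ≡ Σ (λ j → g (j ↑ˡ n) (w i j))
  Σ-row-↑ʳ g g0≡0 i = begin
    Σ (λ y → g y (H (n ↑ʳ i) y))
      ≡⟨ Σ-↑ˡ-↑ʳ n n (λ y → g y (H (n ↑ʳ i) y)) ⟩
    Σ (λ j → g (j ↑ˡ n) (H (n ↑ʳ i) (j ↑ˡ n))) + Σ (λ j → g (n ↑ʳ j) (H (n ↑ʳ i) (n ↑ʳ j)))
      ≡⟨ cong₂ _+_ (Σ-cong λ j → cong (g _) (H-↑ʳ-↑ˡ i j))
                   (Σ-cong λ j → trans (cong (g _) (H-↑ʳ-↑ʳ i j)) (g0≡0 _)) ⟩
    Σ (λ j → g (j ↑ˡ n) (w i j)) + Σ {n} (λ _ → 0ℚ)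
      ≡⟨ cong (Σ (λ j → g (j ↑ˡ n) (w i j)) +_) (Σ-zero n) ⟩
    Σ (λ j → g (j ↑ˡ n) (w i j)) + 0ℚ
      ≡⟨ +-identityʳ (Σ (λ j → g (j ↑ˡ n) (w i j))) ⟩
    Σ (λ j → g (j ↑ˡ n) (w i j)) ∎
    where open ≡-Reasoning

  deg-↑ˡ : ∀ i → deg H (i ↑ˡ n) ≡ deg w i
  deg-↑ˡ = Σ-row-↑ˡ (λ _ x → x) (λ _ → refl)

  deg-↑ʳ : ∀ i → deg H (n ↑ʳ i) ≡ deg w i
  deg-↑ʳ = Σ-row-↑ʳ (λ _ x → x) (λ _ → refl)

  [copies∋↑ˡ] : (S T : Subset n) → ∀ i → [ copies S T ∋ i ↑ˡ n ] ≡ [ S ∋ i ]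
  [copies∋↑ˡ] S T i = cong (if_then 1ℚ else 0ℚ) (lookup-++ˡ S T i)

  [copies∋↑ʳ] : (S T : Subset n) → ∀ i → [ copies S T ∋ n ↑ʳ i ] ≡ [ T ∋ i ]
  [copies∋↑ʳ] S T i = cong (if_then 1ℚ else 0ℚ) (lookup-++ʳ S T i)

  ∁-copies : (S T : Subset n) → ∁ (copies S T) ≡ copies (∁ S) (∁ T)
  ∁-copies = map-++ not

  vol-copies : (S T : Subset n) → vol H (copies S T) ≡ vol w S + vol w T
  vol-copies S T = trans (Σ-↑ˡ-↑ʳ n n (λ x → [ copies S T ∋ x ] * deg H x)) (cong₂ _+_
    (Σ-cong λ i → cong₂ _*_ ([copies∋↑ˡ] S T i) (deg-↑ˡ i))
    (Σ-cong λ i → cong₂ _*_ ([copies∋↑ʳ] S T i) (deg-↑ʳ i)))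

  cut-copies : (A B C D : Subset n) → cut H (copies A B) (copies C D) ≡ cut w A D + cut w B C
  cut-copies A B C D = trans (Σ-↑ˡ-↑ʳ n n row) (cong₂ _+_
    (Σ-cong λ i → trans (Σ-row-↑ˡ (term (i ↑ˡ n)) (term-zero (i ↑ˡ n)) i)
                        (Σ-cong λ j → cong₂ (λ a b → a * (b * w i j))
                                            ([copies∋↑ˡ] A B i) ([copies∋↑ʳ] C D j)))
    (Σ-cong λ i → trans (Σ-row-↑ʳ (term (n ↑ʳ i)) (term-zero (n ↑ʳ i)) i)
                        (Σ-cong λ j → cong₂ (λ a b → a * (b * w i j))
                                            ([copies∋↑ʳ] A B i) ([copies∋↑ˡ] C D j))))
    where
      term : Fin (n ℕ.+ n) → Fin (n ℕ.+ n) → ℚ → ℚ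
      term x y h = [ copies A B ∋ x ] * ([ copies C D ∋ y ] * h)
      term-zero : ∀ x y → term x y 0ℚ ≡ 0ℚ
      term-zero x y =
        trans (cong ([ copies A B ∋ x ] *_) (*-zeroʳ [ copies C D ∋ y ])) (*-zeroʳ [ copies A B ∋ x ])
      row : Fin (n ℕ.+ n) → ℚ
      row x = Σ (λ y → term x y (H x y))

/?-complement : ∀ {p q r} → r ≢ 0ℚ → p + q ≡ r → p /? r ≡ 1ℚ - q /? r
/?-complement {p} {q} {r} r≢0 p+q≡r with r ≟ 0ℚ
... | yes r≡0 = contradiction r≡0 r≢0
... | no r≢0′ = begin
  p * 1/ r                  ≡⟨ solve 3 (λ p q s → p :* s := (p :+ q) :* s :- q :* s) refl p q (1/ r) ⟩
  (p + q) * 1/ r - q * 1/ r ≡⟨ cong (λ x → x * 1/ r - q * 1/ r) p+q≡r ⟩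
  r * 1/ r - q * 1/ r       ≡⟨ cong (_- q * 1/ r) (*-inverseʳ r) ⟩
  1ℚ - q * 1/ r             ∎
  where
    open ≡-Reasoning
    open +-*-Solver
    instance _ = ≢-nonZero r≢0′

module _ (w : Weight n) {L R : Subset n} (L∩R≡∅ : Empty (L ∩ R)) where

  open DoubleCover w

  private
    S : Subset (n ℕ.+ n)
    S = copies L R

  vol-copies-⊓ : NonNegative w → vol H S ⊓ vol H (∁ S) ≡ vol w (L ∪ R)
  vol-copies-⊓ w≥0 =
    trans (p≤q⇒p⊓q≡p vol[S]≤vol[∁S]) (trans (vol-copies L R) (sym (vol-∪ w L∩R≡∅)))
    where
      open ≤-Reasoning
      R∩L≡∅ : Empty (R ∩ L)
      R∩L≡∅ = subst Empty (∩-comm L R) L∩R≡∅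
      vol[S]≤vol[∁S] : vol H S ≤ vol H (∁ S)
      vol[S]≤vol[∁S] = begin
        vol H S                    ≡⟨ vol-copies L R ⟩
        vol w L + vol w R          ≤⟨ +-mono-≤ (vol-mono w w≥0 (disjoint⇒⊆∁ L∩R≡∅))
                                               (vol-mono w w≥0 (disjoint⇒⊆∁ R∩L≡∅)) ⟩
        vol w (∁ R) + vol w (∁ L)  ≡⟨ +-comm (vol w (∁ R)) (vol w (∁ L)) ⟩
        vol w (∁ L) + vol w (∁ R)  ≡⟨ vol-copies (∁ L) (∁ R) ⟨
        vol H (copies (∁ L) (∁ R)) ≡⟨ cong (vol H) (∁-copies L R) ⟨
        vol H (∁ S)                ∎

  cut-copies-∁ : Symmetric w → cut H S (∁ S) + (1ℚ + 1ℚ) * cut w L R ≡ vol w (L ∪ R)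
  cut-copies-∁ w-sym = begin
    cut H S (∁ S) + (1ℚ + 1ℚ) * c
      ≡⟨ cong (λ T → cut H S T + (1ℚ + 1ℚ) * c) (∁-copies L R) ⟩
    cut H S (copies (∁ L) (∁ R)) + (1ℚ + 1ℚ) * c
      ≡⟨ cong (_+ (1ℚ + 1ℚ) * c) (cut-copies L R (∁ L) (∁ R)) ⟩
    (cut w L (∁ R) + cut w R (∁ L)) + (1ℚ + 1ℚ) * c
      ≡⟨ solve 3 (λ a b c → (a :+ b) :+ (con 1ℚ :+ con 1ℚ) :* c := (c :+ a) :+ (c :+ b)) refl
               (cut w L (∁ R)) (cut w R (∁ L)) c ⟩
    (c + cut w L (∁ R)) + (c + cut w R (∁ L))
      ≡⟨ cong (λ x → (c + cut w L (∁ R)) + (x + cut w R (∁ L))) (cut-comm w w-sym L R) ⟩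
    (cut w L R + cut w L (∁ R)) + (cut w R L + cut w R (∁ L))
      ≡⟨ cong₂ _+_ (vol≡cut+cut∁ w L R) (vol≡cut+cut∁ w R L) ⟨
    vol w L + vol w R
      ≡⟨ vol-∪ w L∩R≡∅ ⟨
    vol w (L ∪ R) ∎
    where
      open ≡-Reasoning
      open +-*-Solver
      c : ℚ
      c = cut w L R

mainTheorem16 : (n : ℕ) (w : Weight n) → Symmetric w → NonNegative w →
    (L R : Subset n) → Empty (L ∩ R) → Nonempty (L ∪ R) →
    vol w (L ∪ R) ≢ 0ℚ →
    Φ (doubleCover w) (copies L R) ≡ β w L R
mainTheorem16 n w w-sym w≥0 L R L∩R≡∅ _ vol≢0 = begin
  cut H S (∁ S) /? (vol H S ⊓ vol H (∁ S)) ≡⟨ cong (cut H S (∁ S) /?_) (vol-copies-⊓ w L∩R≡∅ w≥0) ⟩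
  cut H S (∁ S) /? vol w (L ∪ R)            ≡⟨ /?-complement vol≢0 (cut-copies-∁ w L∩R≡∅ w-sym) ⟩
  β w L R                                   ∎
  where
    open ≡-Reasoning
    open DoubleCover w using (H)
    S : Subset (n ℕ.+ n)
    S = copies L R
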